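{- Let $p\neq q$ be primes, $r\in\mathbb{F}_p$, and let $G=(V,\lambda)$ be an $\mathbb{F}_p$-labeled $d$-hypergraph on $n$ vertices that is symmetry-purified with respect to a maximal (with respect to inclusion) fully symmetric subset $C\subseteq V$ with $|C|>n/2$. Let $k_p$ be the smallest integer with $p^{k_p}>d$ and $k_q$ the smallest integer with $q^{k_q}>n-|C|$. Then $p^{k_p}q^{k_q}$ is a period of $\mathbf{s}(G;r)$.
   Context: An $\mathbb{F}_p$-labeled $d$-hypergraph on a finite set $V$ is $G=(V,\lambda)$ with $\lambda\colon\mathcal{P}(V)\setminus\{\emptyset\}\to\mathbb{F}_p$ and $\lambda(e)=0$ whenever $|e|>d$; edges are the $e$ with $\lambda(e)\neq0$. It defines $P_G(\bar x)=\sum_e\lambda(e)\prod_{v\in e}x_v$ over $\mathbb{F}_p$. $\mathrm{Sym}(V)$ acts by $\pi(V,\lambda)=(V,{}^\pi\lambda)$, ${}^\pi\lambda(e)=\lambda(\pi^{ -1}(e))$; $\mathrm{Aut}(G)=\{\pi:\pi G=G\}$. For $z,r\in\mathbb{F}_p$, $\mathbf{b}(z;r)\in\{0,1\}\subseteq\mathbb{F}_q$ is $1$ iff $z=r$. For a left transversal $\pi_1,\dots,\pi_k$ of $\mathrm{Aut}(G)$ in $\mathrm{Sym}(V)$, $\mathbf{s}(G;r)\colon\{0,1\}^V\to\mathbb{F}_q$ is $\bar x\mapsto\sum_{i=1}^k\mathbf{b}(P_{\pi_iG}(\bar x);r)$; it is independent of the transversal and invariant under permuting coordinates, so writing $V=\{v_1,\dots,v_n\}$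 it is determined by $m\mapsto\mathbf{s}(G;r)(1^m0^{n-m})$ for $0\leq m\leq n$. A positive integer $\rho$ is a period if this function satisfies $f(m+\rho)=f(m)$ for all $0\leq m\leq n-\rho$. $C$ is fully symmetric in $G$ if $\lambda(e_1)=\lambda(e_2)$ for all nonempty $e_1,e_2\subseteq V$ with $|e_1|=|e_2|$ and $e_1\setminus C=e_2\setminus C$. $G$ is symmetry-purified with respect to $C$ if (1) $C$ is fully symmetric, (2) every edge is contained in $C$ or in $V\setminus C$, (3) every edge contained in $V\setminus C$ has size $1$. -}

module Defs where

open import Data.Nat using (ℕ; zero; suc; _+_; _*_; _^_; _<_; _≤_; _<ᵇ_; NonZero; _%_)
import Data.Nat as ℕ
import Data.Fin as F
open import Data.Sum using (_⊎_)
open import Data.Bool using (Bool; true; false; if_then_else_)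
open import Data.Fin using (Fin; toℕ)
open import Data.Fin.Subset using (Subset; inside; outside; ∣_∣; _⊆_; ∁; _∩_; Nonempty)
open import Data.Fin.Permutation using (Permutation′; _⟨$⟩ʳ_)
open import Data.Vec using (Vec; []; _∷_; tabulate; lookup)
open import Data.List using (List; []; _∷_; _++_; map)
open import Data.Nat.ListAction using (sum)
open import Data.Product using (Σ; _×_)
open import Relation.Binary.PropositionalEquality using (_≡_; _≢_)
open import Relation.Nullary using (yes; no)

-- The paper's lab is
-- defined on nonempty subsets only; we represent it by a total function with
-- the normalisation lab ∅ = 0 (see IsHypergraph).
Labeling : ℕ → ℕ → Set
Labeling p n = Subset n → Fin p

IsHypergraph : ∀ {p n} → ℕ → Labeling p n → Set
IsHypergraph {p} {n} d lab =
  (∀ (e : Subset n) → ∣ e ∣ ≡ 0 → toℕ (lab e) ≡ 0) ×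
  (∀ (e : Subset n) → d < ∣ e ∣ → toℕ (lab e) ≡ 0)

allSubsets : ∀ n → List (Subset n)
allSubsets zero = [] ∷ []
allSubsets (suc n) = map (outside ∷_) (allSubsets n) ++ map (inside ∷_) (allSubsets n)

prodIn : ∀ {n} → Subset n → (Fin n → ℕ) → ℕ
prodIn [] x = 1
prodIn (b ∷ e) x = (if b then x F.zero else 1) * prodIn e (λ v → x (F.suc v))

P : ∀ {p n} .{{_ : NonZero p}} → Labeling p n → (Fin n → ℕ) → ℕ
P {p} {n} lab x = sum (map (λ e → toℕ (lab e) * prodIn e x) (allSubsets n)) % p

preimage : ∀ {n} → Permutation′ n → Subset n → Subset n
preimage π e = tabulate (λ v → lookup e (π ⟨$⟩ʳ v))

act : ∀ {p n} → Permutation′ n → Labeling p n → Labeling p n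
act π lab e = lab (preimage π e)

IsAut : ∀ {p n} → Labeling p n → Permutation′ n → Set
IsAut {p} {n} lab π = ∀ (e : Subset n) → act π lab e ≡ lab e

InLeftCoset : ∀ {p n} → Labeling p n → Permutation′ n → Permutation′ n → Set
InLeftCoset {p} {n} lab π σ =
  Σ (Permutation′ n) (λ a → IsAut lab a × (∀ (v : Fin n) → σ ⟨$⟩ʳ v ≡ π ⟨$⟩ʳ (a ⟨$⟩ʳ v)))

IsLeftTransversal : ∀ {p n k} → Labeling p n → (Fin k → Permutation′ n) → Set
IsLeftTransversal {p} {n} {k} lab πs =
  ∀ (σ : Permutation′ n) →
    Σ (Fin k) (λ i → InLeftCoset lab (πs i) σ × (∀ (j : Fin k) → InLeftCoset lab (πs j) σ → j ≡ i))

b : ∀ {p} → ℕ → Fin p → ℕ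
b z r with z ℕ.≟ toℕ r
... | yes _ = 1
... | no _ = 0

sumFin : ∀ {k} → (Fin k → ℕ) → ℕ
sumFin {zero} f = 0
sumFin {suc k} f = f F.zero + sumFin (λ i → f (F.suc i))

boolToℕ : Bool → ℕ
boolToℕ true = 1
boolToℕ false = 0

s : ∀ {p q n k} .{{_ : NonZero p}} .{{_ : NonZero q}} →
    Labeling p n → (Fin k → Permutation′ n) → Fin p → (Fin n → Bool) → ℕ
s {p} {q} lab πs r x = sumFin (λ i → b (P (act (πs i) lab) (λ v → boolToℕ (x v))) r) % q

ones : ∀ {n} → ℕ → Fin n → Bool
ones m v = toℕ v <ᵇ m

IsPeriod : ∀ {n} → ((Fin n → Bool) → ℕ) → ℕ → Set
IsPeriod {n} f ρ = 0 < ρ × (∀ m → m + ρ ≤ n → f (ones (m + ρ)) ≡ f (ones m))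

FullySymmetric : ∀ {p n} → Labeling p n → Subset n → Set
FullySymmetric {p} {n} lab C =
  ∀ (e₁ e₂ : Subset n) → Nonempty e₁ → Nonempty e₂ → ∣ e₁ ∣ ≡ ∣ e₂ ∣ →
    e₁ ∩ ∁ C ≡ e₂ ∩ ∁ C → lab e₁ ≡ lab e₂

MaximalFullySymmetric : ∀ {p n} → Labeling p n → Subset n → Set
MaximalFullySymmetric {p} {n} lab C =
  FullySymmetric lab C × (∀ (C' : Subset n) → C ⊆ C' → FullySymmetric lab C' → C' ⊆ C)

SymmetryPurified : ∀ {p n} → Labeling p n → Subset n → Set
SymmetryPurified {p} {n} lab C =
  FullySymmetric lab C ×
  (∀ (e : Subset n) → toℕ (lab e) ≢ 0 → (e ⊆ C) ⊎ (e ⊆ ∁ C)) ×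
  (∀ (e : Subset n) → toℕ (lab e) ≢ 0 → e ⊆ ∁ C → ∣ e ∣ ≡ 1)

IsLeastExpAbove : ℕ → ℕ → ℕ → Set
IsLeastExpAbove a c k = c < a ^ k × (∀ j → c < a ^ j → k ≤ j)

-- Fix a window W = [m, m + ρ) of vertices, ρ = pᵏ qᵏ, and let σ rotate W by pᵏ (order qᵏ) and σ′
-- rotate it by qᵏ (order pᵏ); both fix the inputs 1^m 0^(n-m) and 1^(m+ρ) 0^(n-m-ρ). When a map of
-- ℓ-power order acts on a finite set, an invariant sum is congruent mod ℓ to its part over the fixed
-- points. σ acts on the cosets πᵢ Aut(G) leaving the terms of s invariant, so mod q only σ-fixed
-- cosets count. For such a coset πᵢ⁻¹ σ πᵢ is an automorphism. Automorphisms preserve C (a large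
-- edge inside C can be moved onto any vertex of C by full symmetry; without one, C could be
-- enlarged), and an orbit of length qᵏ > n - |C| does not fit outside C, so πᵢ⁻¹(W) ⊆ C. Full
-- symmetry then makes πᵢ G invariant under σ′, and mod p only σ′-stable vertex sets matter in
-- P_{πᵢ G}: those meeting W contain a σ′-orbit of size pᵏ > d and are not edges, and on the others
-- the two inputs agree.

module Submission where

open import Defs
open import Data.Nat using (ℕ; _*_; _^_; _<_; _∸_)
open import Data.Nat.Primality using (Prime; prime⇒nonZero)
open import Data.Fin using (Fin)
open import Data.Fin.Subset using (Subset; ∣_∣)
open import Data.Fin.Permutation using (Permutation′)
open import Relation.Binary.PropositionalEquality using (_≢_)

open import Data.Nat
open import Data.Nat.Properties
open import Data.Nat.DivMod
open import Data.Nat.GCD using (GCD; module Bézout)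
open import Data.Nat.Coprimality using (prime⇒coprime; coprime⇒GCD≡1)
open import Data.Nat.ListAction using (sum)
open import Data.Nat.ListAction.Properties using (sum-↭)
open import Data.Nat.Induction using (<-wellFounded)
open import Data.Nat.Tactic.RingSolver using (solve-∀)
open import Induction.WellFounded using (Acc; acc)
open import Data.Bool using (Bool; true; false; if_then_else_; T)
import Data.Bool.Properties as Bool
open import Data.Fin using (zero; suc; toℕ; fromℕ<)
import Data.Fin.Properties as Fin
open import Data.Fin.Permutation
  using (permutation; _⟨$⟩ʳ_; _⟨$⟩ˡ_; inverseˡ; inverseʳ; flip; transpose; _∘ₚ_; id)
open import Data.Fin.Subset using (inside; outside; _-_; ⁅_⁆; _⊆_; _∩_; _∪_; ∁; Nonempty)
  renaming (_∈_ to _∈ₛ_; _∉_ to _∉ₛ_)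
open import Data.Fin.Subset.Properties
  using (⊆-antisym; _⊆?_; x∈p∧x≢y⇒x∈p-y; x∈p⇒∣p-x∣<∣p∣; x∈⁅x⁆; x∈⁅y⁆⇒x≡y; ∣⁅x⁆∣≡1; nonempty?; Empty-unique; ∣⊥∣≡0;
         x∈p∩q⁺; x∈p∩q⁻; x∈∁p⇒x∉p; x∉p⇒x∈∁p; ∣∁p∣≡n∸∣p∣; x∈p∪q⁺; x∈p∪q⁻; p⊆p∪q; anySubset?)
  renaming (_∈?_ to _∈ₛ?_)
open import Data.Vec using ([]; _∷_; lookup)
import Data.Vec as Vec
import Data.Vec.Properties as Vecₚ
open import Data.List using (List; []; _∷_; map; filter; applyUpTo; length; _++_; allFin; tabulate)
open import Data.List.Properties
  using (map-∘; map-tabulate; tabulate-cong; length-applyUpTo; filter-all; filter-notAll; filter-accept; filter-reject)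
open import Data.List.Membership.Propositional using (_∈_)
open import Data.List.Membership.Propositional.Properties
  using (∈-map⁺; ∈-map⁻; ∈-++⁺ˡ; ∈-++⁺ʳ; ∈-allFin; ∈-filter⁺; ∈-filter⁻; ∈-applyUpTo⁺; ∈-applyUpTo⁻)
open import Data.List.Membership.Propositional.Properties.WithK using (unique∧set⇒bag)
open import Data.List.Relation.Unary.Any using (here; there)
import Data.List.Relation.Unary.All as All
open import Data.List.Relation.Unary.Unique.Propositional using (Unique; []; _∷_)
import Data.List.Relation.Unary.Unique.Propositional.Properties as Unique
open import Data.List.Relation.Binary.Permutation.Propositional using (_↭_)
import Data.List.Relation.Binary.Permutation.Propositional.Properties as ↭
open import Data.List.Relation.Binary.BagAndSetEquality using (∼bag⇒↭)
open import Data.Product using (Σ; ∃-syntax; _×_; _,_; proj₁; proj₂; uncurry)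
open import Data.Sum using (_⊎_; inj₁; inj₂)
open import Data.Unit using (tt)
open import Function using (_∘_; mk⇔; Injective; Equivalence)
open import Relation.Binary.Definitions using (DecidableEquality)
open import Relation.Binary.PropositionalEquality
open import Relation.Nullary using (¬_; Dec; yes; no; contradiction; _×-dec_; ¬?)
open import Relation.Nullary.Decidable using (dec-true; dec-false)
open import Relation.Unary using (Decidable)
open import Relation.Unary.Properties using (∁?)

iter : {A : Set} → (A → A) → ℕ → A → A
iter f zero a = a
iter f (suc j) a = f (iter f j a)

module _ {A : Set} (f : A → A) where

  iter-+ : ∀ i j a → iter f (i + j) a ≡ iter f i (iter f j a)
  iter-+ zero j a = refl
  iter-+ (suc i) j a = cong f (iter-+ i j a)

  iter-suc : ∀ j a → iter f j (f a) ≡ f (iter f j a)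
  iter-suc j a = begin
    iter f j (f a)     ≡⟨ iter-+ j 1 a ⟨
    iter f (j + 1) a   ≡⟨ cong (λ i → iter f i a) (+-comm j 1) ⟩
    f (iter f j a)     ∎
    where open ≡-Reasoning

  iter-iter : ∀ k j a → iter (iter f k) j a ≡ iter f (j * k) a
  iter-iter k zero a = refl
  iter-iter k (suc j) a = trans (cong (iter f k) (iter-iter k j a)) (sym (iter-+ k (j * k) a))

  iter-comm : ∀ i j a → iter f i (iter f j a) ≡ iter f j (iter f i a)
  iter-comm i j a = begin
    iter f i (iter f j a)  ≡⟨ iter-+ i j a ⟨
    iter f (i + j) a       ≡⟨ cong (λ k → iter f k a) (+-comm i j) ⟩
    iter f (j + i) a       ≡⟨ iter-+ j i a ⟩
    iter f j (iter f i a)  ∎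
    where open ≡-Reasoning

  iter-fixed : ∀ {a} → f a ≡ a → ∀ j → iter f j a ≡ a
  iter-fixed fix zero = refl
  iter-fixed fix (suc j) = trans (cong f (iter-fixed fix j)) fix

  iter-fixed-* : ∀ {d a} → iter f d a ≡ a → ∀ c → iter f (c * d) a ≡ a
  iter-fixed-* fix zero = refl
  iter-fixed-* {d} {a} fix (suc c) =
    trans (iter-+ d (c * d) a) (trans (cong (iter f d) (iter-fixed-* fix c)) fix)

  iter-fixed-gcd : ∀ {m n d a} → GCD m n d → iter f m a ≡ a → iter f n a ≡ a → iter f d a ≡ a
  iter-fixed-gcd {m} {n} {d} {a} gcd fm fn with Bézout.identity gcd
  ... | Bézout.+- x y eq = begin
    iter f d a                  ≡⟨ cong (iter f d) (iter-fixed-* fn y) ⟨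
    iter f d (iter f (y * n) a) ≡⟨ iter-+ d (y * n) a ⟨
    iter f (d + y * n) a        ≡⟨ cong (λ i → iter f i a) eq ⟩
    iter f (x * m) a            ≡⟨ iter-fixed-* fm x ⟩
    a                           ∎
    where open ≡-Reasoning
  ... | Bézout.-+ x y eq = begin
    iter f d a                  ≡⟨ cong (iter f d) (iter-fixed-* fm x) ⟨
    iter f d (iter f (x * m) a) ≡⟨ iter-+ d (x * m) a ⟨
    iter f (d + x * m) a        ≡⟨ cong (λ i → iter f i a) eq ⟩
    iter f (y * n) a            ≡⟨ iter-fixed-* fn y ⟩
    a                           ∎
    where open ≡-Reasoning

  iter-fixed-prime : ∀ {ℓ d a} → Prime ℓ → 0 < d → d < ℓ →
                     iter f ℓ a ≡ a → iter f d a ≡ a → f a ≡ a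
  iter-fixed-prime ℓ-prime 0<d d<ℓ fℓ fd =
    iter-fixed-gcd (coprime⇒GCD≡1 (prime⇒coprime ℓ-prime {{>-nonZero 0<d}} d<ℓ)) fℓ fd

  iter-injective : Injective _≡_ _≡_ f → ∀ j → Injective _≡_ _≡_ (iter f j)
  iter-injective inj zero eq = eq
  iter-injective inj (suc j) eq = iter-injective inj j (inj eq)

  periodic⇒inverse : ∀ j → (∀ a → iter f (suc j) a ≡ a) →
                     (∀ a → f (iter f j a) ≡ a) × (∀ a → iter f j (f a) ≡ a)
  periodic⇒inverse j per = per , λ a → trans (iter-suc j a) (per a)

  periodic⇒injective : ∀ j → (∀ a → iter f (suc j) a ≡ a) → Injective _≡_ _≡_ f
  periodic⇒injective j per {a} {b} eq = begin
    a                ≡⟨ proj₂ (periodic⇒inverse j per) a ⟨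
    iter f j (f a)   ≡⟨ cong (iter f j) eq ⟩
    iter f j (f b)   ≡⟨ proj₂ (periodic⇒inverse j per) b ⟩
    b                ∎
    where open ≡-Reasoning

  orbit : ℕ → A → List A
  orbit t a = applyUpTo (λ j → iter f j a) t

  orbit-unique : Injective _≡_ _≡_ f → ∀ t a → (∀ {j} → 0 < j → j < t → iter f j a ≢ a) → Unique (orbit t a)
  orbit-unique inj t a aperiodic = Unique.applyUpTo⁺₁ _ t distinct
    where
    distinct : ∀ {i j} → i < j → j < t → iter f i a ≢ iter f j a
    distinct {i} {j} i<j j<t eq =
      aperiodic (m<n⇒0<n∸m i<j) (≤-<-trans (m∸n≤m j i) j<t) (iter-injective inj i returns)
      where
      open ≡-Reasoning
      returns : iter f i (iter f (j ∸ i) a) ≡ iter f i a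
      returns = begin
        iter f i (iter f (j ∸ i) a) ≡⟨ iter-+ i (j ∸ i) a ⟨
        iter f (i + (j ∸ i)) a      ≡⟨ cong (λ k → iter f k a) (m+[n∸m]≡n (<⇒≤ i<j)) ⟩
        iter f j a                  ≡⟨ eq ⟨
        iter f i a                  ∎

iter-preserves : ∀ {A : Set} {τ : A → A} (F : A → ℕ) → (∀ a → F (τ a) ≡ F a) → ∀ j a → F (iter τ j a) ≡ F a
iter-preserves F inv zero a = refl
iter-preserves F inv (suc j) a = trans (inv _) (iter-preserves F inv j a)

iter-conj : ∀ {A B : Set} {f : A → A} {g : B → B} (h : B → A) → (∀ b → f (h b) ≡ h (g b)) →
            ∀ j b → iter f j (h b) ≡ h (iter g j b)
iter-conj h comm zero b = refl
iter-conj {f = f} h comm (suc j) b = trans (cong f (iter-conj h comm j b)) (comm _)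

module _ {A : Set} where

  ∑ : List A → (A → ℕ) → ℕ
  ∑ xs F = sum (map F xs)

  ∑-cong : ∀ xs {F G : A → ℕ} → (∀ {a} → a ∈ xs → F a ≡ G a) → ∑ xs F ≡ ∑ xs G
  ∑-cong [] eq = refl
  ∑-cong (x ∷ xs) eq = cong₂ _+_ (eq (here refl)) (∑-cong xs (eq ∘ there))

  ∑-filter : ∀ {P : A → Set} (P? : Decidable P) xs (F : A → ℕ) →
             ∑ xs F ≡ ∑ (filter P? xs) F + ∑ (filter (∁? P?) xs) F
  ∑-filter P? [] F = refl
  ∑-filter P? (x ∷ xs) F with P? x
  ... | yes _ = trans (cong (F x +_) (∑-filter P? xs F)) (sym (+-assoc (F x) (∑ (filter P? xs) F) _))
  ... | no _ = trans (cong (F x +_) (∑-filter P? xs F)) (+-exchange (F x) (∑ (filter P? xs) F) _)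
    where
    +-exchange : ∀ a b c → a + (b + c) ≡ b + (a + c)
    +-exchange = solve-∀

  ∑-↭ : ∀ {xs ys} (F : A → ℕ) → xs ↭ ys → ∑ xs F ≡ ∑ ys F
  ∑-↭ F p = sum-↭ (↭.map⁺ F p)

  unique-⇔⇒↭ : ∀ {xs ys} → Unique xs → Unique ys → (∀ {a} → a ∈ xs → a ∈ ys) → (∀ {a} → a ∈ ys → a ∈ xs) → xs ↭ ys
  unique-⇔⇒↭ !xs !ys to from = ∼bag⇒↭ {A = A} (unique∧set⇒bag !xs !ys (mk⇔ to from))

  ∑-reindex : ∀ {xs} → Unique xs → (∀ a → a ∈ xs) → (f g : A → A) → (∀ a → f (g a) ≡ a) → (∀ a → g (f a) ≡ a) →
              (F : A → ℕ) → ∑ xs (F ∘ f) ≡ ∑ xs F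
  ∑-reindex {xs} !xs complete f g fg gf F = begin
    ∑ xs (F ∘ f)       ≡⟨ cong sum (map-∘ {g = F} {f = f} xs) ⟩
    ∑ (map f xs) F     ≡⟨ ∑-↭ F (unique-⇔⇒↭ (Unique.map⁺ f-inj !xs) !xs (λ _ → complete _) image) ⟩
    ∑ xs F             ∎
    where
    open ≡-Reasoning
    f-inj : Injective _≡_ _≡_ f
    f-inj {a} {b} eq = trans (sym (gf a)) (trans (cong g eq) (gf b))
    image : ∀ {a} → a ∈ xs → a ∈ map f xs
    image {a} _ = subst (_∈ map f xs) (fg a) (∈-map⁺ f (complete (g a)))

  ∑-applyUpTo-const : ∀ (h : ℕ → A) t (F : A → ℕ) {c} → (∀ j → F (h j) ≡ c) → ∑ (applyUpTo h t) F ≡ t * c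
  ∑-applyUpTo-const h zero F const = refl
  ∑-applyUpTo-const h (suc t) F const = cong₂ _+_ (const 0) (∑-applyUpTo-const (h ∘ suc) t F (const ∘ suc))

iter-closed : ∀ {A : Set} {τ : A → A} {xs : List A} → (∀ {a} → a ∈ xs → τ a ∈ xs) → ∀ j {a} → a ∈ xs → iter τ j a ∈ xs
iter-closed cl zero a∈xs = a∈xs
iter-closed cl (suc j) a∈xs = cl (iter-closed cl j a∈xs)

filter-filter-⇒ : ∀ {A : Set} {P Q : A → Set} (P? : Decidable P) (Q? : Decidable Q) → (∀ {a} → P a → Q a) →
                  ∀ xs → filter P? (filter Q? xs) ≡ filter P? xs
filter-filter-⇒ P? Q? P⇒Q [] = refl
filter-filter-⇒ {P = P} {Q} P? Q? P⇒Q (x ∷ xs) = by (P? x) (Q? x)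
  where
  open ≡-Reasoning
  ih = filter-filter-⇒ P? Q? P⇒Q xs
  by : Dec (P x) → Dec (Q x) → filter P? (filter Q? (x ∷ xs)) ≡ filter P? (x ∷ xs)
  by (yes px) _ = begin
    filter P? (filter Q? (x ∷ xs)) ≡⟨ cong (filter P?) (filter-accept Q? (P⇒Q px)) ⟩
    filter P? (x ∷ filter Q? xs)   ≡⟨ filter-accept P? px ⟩
    x ∷ filter P? (filter Q? xs)   ≡⟨ cong (x ∷_) ih ⟩
    x ∷ filter P? xs               ≡⟨ filter-accept P? px ⟨
    filter P? (x ∷ xs)             ∎
  by (no ¬px) (yes qx) = begin
    filter P? (filter Q? (x ∷ xs)) ≡⟨ cong (filter P?) (filter-accept Q? qx) ⟩
    filter P? (x ∷ filter Q? xs)   ≡⟨ filter-reject P? ¬px ⟩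
    filter P? (filter Q? xs)       ≡⟨ ih ⟩
    filter P? xs                   ≡⟨ filter-reject P? ¬px ⟨
    filter P? (x ∷ xs)             ∎
  by (no ¬px) (no ¬qx) = begin
    filter P? (filter Q? (x ∷ xs)) ≡⟨ cong (filter P?) (filter-reject Q? ¬qx) ⟩
    filter P? (filter Q? xs)       ≡⟨ ih ⟩
    filter P? xs                   ≡⟨ filter-reject P? ¬px ⟨
    filter P? (x ∷ xs)             ∎

-- Sums modulo ℓ over the fixed points of a map of ℓ-power order

module _ {A : Set} (_≟_ : DecidableEquality A) where

  open import Data.List.Membership.DecPropositional _≟_ using (_∈?_)

  fixedPoints : (A → A) → List A → List A
  fixedPoints τ = filter (λ a → τ a ≟ a)

  Closed : (A → A) → List A → Set
  Closed τ xs = ∀ {a} → a ∈ xs → τ a ∈ xs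

  module _ {ℓ} (ℓ-prime : Prime ℓ) {τ : A → A} (τ-inj : Injective _≡_ _≡_ τ) where

    private
      ℓ-1 : ℕ
      ℓ-1 = pred ℓ
      ℓ≡suc : ℓ ≡ suc ℓ-1
      ℓ≡suc = sym (suc-pred ℓ {{prime⇒nonZero ℓ-prime}})

    module _ {a} (a-periodic : iter τ ℓ a ≡ a) where

      ∈-orbit-self : a ∈ orbit τ ℓ a
      ∈-orbit-self = ∈-applyUpTo⁺ _ (subst (0 <_) (sym ℓ≡suc) (s≤s z≤n))

      orbit-closed⁻ : ∀ {x} → τ x ∈ orbit τ ℓ a → x ∈ orbit τ ℓ a
      orbit-closed⁻ τx∈O with ∈-applyUpTo⁻ _ τx∈O
      ... | suc j , j<ℓ , τx≡ = subst (_∈ orbit τ ℓ a) (sym (τ-inj τx≡)) (∈-applyUpTo⁺ _ (<-trans (n<1+n j) j<ℓ))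
      ... | zero , _ , τx≡a = subst (_∈ orbit τ ℓ a) (sym (τ-inj τx≡τℓ-1a)) (∈-applyUpTo⁺ _ ℓ-1<ℓ)
        where
        τx≡τℓ-1a = trans τx≡a (trans (sym a-periodic) (cong (λ k → iter τ k a) ℓ≡suc))
        ℓ-1<ℓ = subst (ℓ-1 <_) (sym ℓ≡suc) (n<1+n ℓ-1)

      orbit-unique-prime : τ a ≢ a → Unique (orbit τ ℓ a)
      orbit-unique-prime moved = orbit-unique τ τ-inj ℓ a λ 0<j j<ℓ fixed →
        moved (iter-fixed-prime τ ℓ-prime 0<j j<ℓ a-periodic fixed)

    module _ (F : A → ℕ) (F-inv : ∀ a → F (τ a) ≡ F a) where

      -- peel off the orbit of the first point: ℓ distinct points on which F is constant
      ∑-fixedPointFree : ∀ ys → Acc _<_ (length ys) → Unique ys → Closed τ ys →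
                         (∀ {a} → a ∈ ys → τ a ≢ a) → (∀ {a} → a ∈ ys → iter τ ℓ a ≡ a) →
                         ∃[ c ] ∑ ys F ≡ ℓ * c
      ∑-fixedPointFree [] _ _ _ _ _ = 0 , sym (*-zeroʳ ℓ)
      ∑-fixedPointFree ys@(a ∷ _) (acc rec) !ys closed free periodic = F a + c , (begin
        ∑ ys F                                  ≡⟨ ∑-filter (_∈? O) ys F ⟩
        ∑ (filter (_∈? O) ys) F + ∑ rest F      ≡⟨ cong₂ _+_ (∑-↭ F O-part) rest-sum ⟩
        ∑ O F + ℓ * c                           ≡⟨ cong (_+ ℓ * c) O-sum ⟩
        ℓ * F a + ℓ * c                         ≡⟨ *-distribˡ-+ ℓ (F a) c ⟨
        ℓ * (F a + c)                           ∎)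
        where
        open ≡-Reasoning
        O = orbit τ ℓ a
        O-sum : ∑ O F ≡ ℓ * F a
        O-sum = ∑-applyUpTo-const _ ℓ F (λ j → iter-preserves F F-inv j a)
        a-periodic = periodic (here refl)
        O⊆ys : ∀ {x} → x ∈ O → x ∈ ys
        O⊆ys x∈O with j , _ , refl ← ∈-applyUpTo⁻ _ x∈O = iter-closed closed j (here refl)
        O-part : filter (_∈? O) ys ↭ O
        O-part = unique-⇔⇒↭ (Unique.filter⁺ (_∈? O) !ys) (orbit-unique-prime a-periodic (free (here refl)))
                   (proj₂ ∘ ∈-filter⁻ (_∈? O)) (λ x∈O → ∈-filter⁺ (_∈? O) (O⊆ys x∈O) x∈O)
        rest = filter (∁? (_∈? O)) ys
        shorter : length rest < length ys
        shorter = filter-notAll (∁? (_∈? O)) ys (here (λ a∉O → a∉O (∈-orbit-self a-periodic)))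
        rest-closed : Closed τ rest
        rest-closed x∈rest with x∈ys , x∉O ← ∈-filter⁻ (∁? (_∈? O)) x∈rest =
          ∈-filter⁺ (∁? (_∈? O)) (closed x∈ys) (x∉O ∘ orbit-closed⁻ a-periodic)
        recursive : ∃[ c ] ∑ rest F ≡ ℓ * c
        recursive = ∑-fixedPointFree rest (rec shorter) (Unique.filter⁺ (∁? (_∈? O)) !ys) rest-closed
                      (free ∘ proj₁ ∘ ∈-filter⁻ (∁? (_∈? O))) (periodic ∘ proj₁ ∘ ∈-filter⁻ (∁? (_∈? O)))
        c = proj₁ recursive
        rest-sum = proj₂ recursive

      ∑-fixedPoints-prime : ∀ xs → Unique xs → Closed τ xs → (∀ {a} → a ∈ xs → iter τ ℓ a ≡ a) →
                            ∃[ c ] ∑ xs F ≡ ∑ (fixedPoints τ xs) F + ℓ * c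
      ∑-fixedPoints-prime xs !xs closed periodic =
        c , trans (∑-filter fixed? xs F) (cong (∑ (fixedPoints τ xs) F +_) free-sum)
        where
        fixed? = λ a → τ a ≟ a
        free = filter (∁? fixed?) xs
        free-closed : Closed τ free
        free-closed a∈free with a∈xs , τa≢a ← ∈-filter⁻ (∁? fixed?) a∈free =
          ∈-filter⁺ (∁? fixed?) (closed a∈xs) (τa≢a ∘ τ-inj)
        free-multiple : ∃[ c ] ∑ free F ≡ ℓ * c
        free-multiple = ∑-fixedPointFree free (<-wellFounded _) (Unique.filter⁺ (∁? fixed?) !xs) free-closed
                          (proj₂ ∘ ∈-filter⁻ (∁? fixed?) {xs = xs}) (periodic ∘ proj₁ ∘ ∈-filter⁻ (∁? fixed?) {xs = xs})
        c = proj₁ free-multiple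
        free-sum = proj₂ free-multiple

  module _ {ℓ} (ℓ-prime : Prime ℓ) {τ : A → A} (e : ℕ) (τ-periodic : ∀ a → iter τ (ℓ ^ e) a ≡ a)
           {xs} (!xs : Unique xs) (closed : Closed τ xs) where

    private
      instance
        ℓ-nonZero : NonZero ℓ
        ℓ-nonZero = prime⇒nonZero ℓ-prime

      τ-inj : Injective _≡_ _≡_ τ
      τ-inj = periodic⇒injective τ (pred (ℓ ^ e))
                (λ a → subst (λ k → iter τ k a ≡ a) (sym (suc-pred (ℓ ^ e) {{m^n≢0 ℓ e}})) (τ-periodic a))

      periodicPoints : ℕ → List A
      periodicPoints j = fixedPoints (iter τ (ℓ ^ j)) xs

    module _ (F : A → ℕ) (F-inv : ∀ a → F (τ a) ≡ F a) where

      private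
        step : ∀ j → ∃[ c ] ∑ (periodicPoints (suc j)) F ≡ ∑ (periodicPoints j) F + ℓ * c
        step j = c , trans eq (cong (λ zs → ∑ zs F + ℓ * c) (filter-filter-⇒ _ _ fixed⇒periodic xs))
          where
          τʲ = iter τ (ℓ ^ j)
          ys = periodicPoints (suc j)
          fixed⇒periodic : ∀ {a} → τʲ a ≡ a → iter τ (ℓ ^ suc j) a ≡ a
          fixed⇒periodic {a} fix = trans (sym (iter-iter τ (ℓ ^ j) ℓ a)) (iter-fixed τʲ fix ℓ)
          ys-periodic : ∀ {a} → a ∈ ys → iter τʲ ℓ a ≡ a
          ys-periodic {a} a∈ys =
            trans (iter-iter τ (ℓ ^ j) ℓ a) (proj₂ (∈-filter⁻ (λ a → iter τ (ℓ ^ suc j) a ≟ a) {xs = xs} a∈ys))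
          ys-closed : Closed τʲ ys
          ys-closed {a} a∈ys with a∈xs , periodic ← ∈-filter⁻ (λ a → iter τ (ℓ ^ suc j) a ≟ a) {xs = xs} a∈ys =
            ∈-filter⁺ (λ a → iter τ (ℓ ^ suc j) a ≟ a) (iter-closed closed (ℓ ^ j) a∈xs)
              (trans (iter-comm τ (ℓ ^ suc j) (ℓ ^ j) a) (cong τʲ periodic))
          prime-step = ∑-fixedPoints-prime ℓ-prime (iter-injective τ τ-inj (ℓ ^ j)) F (iter-preserves F F-inv (ℓ ^ j))
                         ys (Unique.filter⁺ (λ a → iter τ (ℓ ^ suc j) a ≟ a) !xs) ys-closed ys-periodic
          c = proj₁ prime-step
          eq = proj₂ prime-step

        accumulate : ∀ j → ∃[ c ] ∑ (periodicPoints j) F ≡ ∑ (fixedPoints τ xs) F + ℓ * c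
        accumulate zero = 0 , sym (trans (cong (∑ (fixedPoints τ xs) F +_) (*-zeroʳ ℓ)) (+-identityʳ _))
        accumulate (suc j) with c , eq ← accumulate j | c′ , eq′ ← step j = c + c′ , (begin
          ∑ (periodicPoints (suc j)) F          ≡⟨ eq′ ⟩
          ∑ (periodicPoints j) F + ℓ * c′        ≡⟨ cong (_+ ℓ * c′) eq ⟩
          ∑ (fixedPoints τ xs) F + ℓ * c + ℓ * c′ ≡⟨ +-assoc _ (ℓ * c) (ℓ * c′) ⟩
          ∑ (fixedPoints τ xs) F + (ℓ * c + ℓ * c′) ≡⟨ cong (∑ (fixedPoints τ xs) F +_) (*-distribˡ-+ ℓ c c′) ⟨
          ∑ (fixedPoints τ xs) F + ℓ * (c + c′) ∎)
          where open ≡-Reasoning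

      ∑-fixedPoints-primePower : ∃[ c ] ∑ xs F ≡ ∑ (fixedPoints τ xs) F + ℓ * c
      ∑-fixedPoints-primePower with c , eq ← accumulate e =
        c , trans (cong (λ zs → ∑ zs F) (sym all-periodic)) eq
        where
        all-periodic = filter-all (λ a → iter τ (ℓ ^ e) a ≟ a) {xs = xs} (All.tabulate λ {a} _ → τ-periodic a)

    ∑-mod-fixedPoints : ∀ (F G : A → ℕ) → (∀ a → F (τ a) ≡ F a) → (∀ a → G (τ a) ≡ G a) →
                        (∀ {a} → a ∈ xs → τ a ≡ a → F a ≡ G a) → ∑ xs F % ℓ ≡ ∑ xs G % ℓ
    ∑-mod-fixedPoints F G F-inv G-inv agree = begin
      ∑ xs F % ℓ                       ≡⟨ reduce F F-inv ⟩
      ∑ (fixedPoints τ xs) F % ℓ       ≡⟨ cong (_% ℓ) (∑-cong (fixedPoints τ xs) (uncurry agree ∘ ∈-filter⁻ (λ a → τ a ≟ a))) ⟩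
      ∑ (fixedPoints τ xs) G % ℓ       ≡⟨ reduce G G-inv ⟨
      ∑ xs G % ℓ                       ∎
      where
      open ≡-Reasoning
      reduce : ∀ H → (∀ a → H (τ a) ≡ H a) → ∑ xs H % ℓ ≡ ∑ (fixedPoints τ xs) H % ℓ
      reduce H H-inv with c , eq ← ∑-fixedPoints-primePower H H-inv =
        trans (cong (_% ℓ) (trans eq (cong (∑ (fixedPoints τ xs) H +_) (*-comm ℓ c)))) ([m+kn]%n≡m%n _ c ℓ)

module _ {n : ℕ} where

  -- the preimage f⁻¹(e); Defs.preimage π is definitionally pre (π ⟨$⟩ʳ_)
  pre : (Fin n → Fin n) → Subset n → Subset n
  pre f e = Vec.tabulate (λ v → lookup e (f v))

  lookup-pre : ∀ f e v → lookup (pre f e) v ≡ lookup e (f v)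
  lookup-pre f e v = Vecₚ.lookup∘tabulate _ v

  ∈-pre⁺ : ∀ {f e v} → f v ∈ₛ e → v ∈ₛ pre f e
  ∈-pre⁺ {f} {e} {v} fv∈e = Vecₚ.lookup⇒[]= v (pre f e) (trans (lookup-pre f e v) (Vecₚ.[]=⇒lookup fv∈e))

  ∈-pre⁻ : ∀ {f e v} → v ∈ₛ pre f e → f v ∈ₛ e
  ∈-pre⁻ {f} {e} {v} v∈pre = Vecₚ.lookup⇒[]= (f v) e (trans (sym (lookup-pre f e v)) (Vecₚ.[]=⇒lookup v∈pre))

  pre-cong : ∀ {f g} → (∀ v → f v ≡ g v) → ∀ e → pre f e ≡ pre g e
  pre-cong f≗g e = Vecₚ.tabulate-cong (cong (lookup e) ∘ f≗g)

  pre-id : ∀ e → pre (λ v → v) e ≡ e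
  pre-id = Vecₚ.tabulate∘lookup

  pre-∘ : ∀ f g e → pre f (pre g e) ≡ pre (g ∘ f) e
  pre-∘ f g e = Vecₚ.tabulate-cong (lookup-pre g e ∘ f)

  pre-inverse : ∀ {f g} → (∀ v → g (f v) ≡ v) → ∀ e → pre f (pre g e) ≡ e
  pre-inverse gf e = trans (pre-∘ _ _ e) (trans (pre-cong gf e) (pre-id e))

  pre-iter : ∀ f j e → iter (pre f) j e ≡ pre (iter f j) e
  pre-iter f zero e = sym (pre-id e)
  pre-iter f (suc j) e = begin
    pre f (iter (pre f) j e)  ≡⟨ cong (pre f) (pre-iter f j e) ⟩
    pre f (pre (iter f j) e)  ≡⟨ pre-∘ f (iter f j) e ⟩
    pre (iter f j ∘ f) e      ≡⟨ pre-cong (λ v → iter-suc f j v) e ⟩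
    pre (iter f (suc j)) e    ∎
    where open ≡-Reasoning

∑-allFin : ∀ {k} (f : Fin k → ℕ) → ∑ (allFin k) f ≡ sum (tabulate f)
∑-allFin f = cong sum (map-tabulate (λ i → i) f)

sumFin≡sum-tabulate : ∀ {k} (f : Fin k → ℕ) → sumFin f ≡ sum (tabulate f)
sumFin≡sum-tabulate {zero} f = refl
sumFin≡sum-tabulate {suc k} f = cong (f zero +_) (sumFin≡sum-tabulate (f ∘ suc))

∣∣≡sum-tabulate : ∀ {n} (e : Subset n) → ∣ e ∣ ≡ sum (tabulate (boolToℕ ∘ lookup e))
∣∣≡sum-tabulate [] = refl
∣∣≡sum-tabulate (inside ∷ e) = cong suc (∣∣≡sum-tabulate e)
∣∣≡sum-tabulate (outside ∷ e) = ∣∣≡sum-tabulate e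

∣pre∣ : ∀ {n} {f g : Fin n → Fin n} → (∀ v → f (g v) ≡ v) → (∀ v → g (f v) ≡ v) → ∀ e → ∣ pre f e ∣ ≡ ∣ e ∣
∣pre∣ {n} {f} {g} fg gf e = begin
  ∣ pre f e ∣                                ≡⟨ ∣∣≡sum-tabulate (pre f e) ⟩
  sum (tabulate (boolToℕ ∘ lookup (pre f e))) ≡⟨ cong sum (tabulate-cong (cong boolToℕ ∘ lookup-pre f e)) ⟩
  sum (tabulate (indicator ∘ f))             ≡⟨ ∑-allFin (indicator ∘ f) ⟨
  ∑ (allFin n) (indicator ∘ f)               ≡⟨ ∑-reindex (Unique.allFin⁺ n) ∈-allFin f g fg gf indicator ⟩
  ∑ (allFin n) indicator                     ≡⟨ ∑-allFin indicator ⟩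
  sum (tabulate indicator)                   ≡⟨ ∣∣≡sum-tabulate e ⟨
  ∣ e ∣                                      ∎
  where
  open ≡-Reasoning
  indicator = boolToℕ ∘ lookup e

module _ {n : ℕ} where

  unique⇒length≤∣∣ : ∀ {X : Subset n} {ys} → Unique ys → (∀ {y} → y ∈ ys → y ∈ₛ X) → length ys ≤ ∣ X ∣
  unique⇒length≤∣∣ [] _ = z≤n
  unique⇒length≤∣∣ {X} (y≢ys ∷ !ys) ys⊆X =
    ≤-<-trans (unique⇒length≤∣∣ !ys ys⊆X-y) (x∈p⇒∣p-x∣<∣p∣ (ys⊆X (here refl)))
    where
    ys⊆X-y : ∀ {y′} → y′ ∈ _ → y′ ∈ₛ X - _
    ys⊆X-y y′∈ys = x∈p∧x≢y⇒x∈p-y (ys⊆X (there y′∈ys)) (≢-sym (All.lookup y≢ys y′∈ys))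

  ∈⇒0<∣∣ : ∀ {X : Subset n} {x} → x ∈ₛ X → 0 < ∣ X ∣
  ∈⇒0<∣∣ x∈X = ≤-<-trans z≤n (x∈p⇒∣p-x∣<∣p∣ x∈X)

  ∣∣≡1⇒≡⁅⁆ : ∀ {X : Subset n} {x} → ∣ X ∣ ≡ 1 → x ∈ₛ X → X ≡ ⁅ x ⁆
  ∣∣≡1⇒≡⁅⁆ {X} {x} ∣X∣≡1 x∈X = ⊆-antisym X⊆⁅x⁆ (λ y∈⁅x⁆ → subst (_∈ₛ X) (sym (x∈⁅y⁆⇒x≡y x y∈⁅x⁆)) x∈X)
    where
    X⊆⁅x⁆ : X ⊆ ⁅ x ⁆
    X⊆⁅x⁆ {y} y∈X with y Fin.≟ x
    ... | yes refl = x∈⁅x⁆ x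
    ... | no y≢x = contradiction (unique⇒length≤∣∣ ((y≢x All.∷ All.[]) ∷ All.[] ∷ []) members)
                                 (subst (2 ≰_) (sym ∣X∣≡1) λ { (s≤s ()) })
      where
      members : ∀ {z} → z ∈ y ∷ x ∷ [] → z ∈ₛ X
      members (here refl) = y∈X
      members (there (here refl)) = x∈X

_≟ₛ_ : ∀ {n} → DecidableEquality (Subset n)
_≟ₛ_ = Vecₚ.≡-dec Bool._≟_

allSubsets-complete : ∀ {n} (e : Subset n) → e ∈ allSubsets n
allSubsets-complete [] = here refl
allSubsets-complete {suc n} (outside ∷ e) = ∈-++⁺ˡ (∈-map⁺ (outside ∷_) (allSubsets-complete e))
allSubsets-complete {suc n} (inside ∷ e) =
  ∈-++⁺ʳ (map (outside ∷_) (allSubsets n)) (∈-map⁺ (inside ∷_) (allSubsets-complete e))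

allSubsets-unique : ∀ n → Unique (allSubsets n)
allSubsets-unique zero = All.[] ∷ []
allSubsets-unique (suc n) = Unique.++⁺ (Unique.map⁺ Vecₚ.∷-injectiveʳ (allSubsets-unique n))
                                        (Unique.map⁺ Vecₚ.∷-injectiveʳ (allSubsets-unique n)) disjoint
  where
  disjoint : ∀ {e} → ¬ (e ∈ map (outside ∷_) (allSubsets n) × e ∈ map (inside ∷_) (allSubsets n))
  disjoint (e∈outs , e∈ins) with _ , _ , refl ← ∈-map⁻ (outside ∷_) e∈outs | _ , _ , () ← ∈-map⁻ (inside ∷_) e∈ins

prodIn-cong : ∀ {n} (e : Subset n) {x y : Fin n → ℕ} → (∀ {v} → v ∈ₛ e → x v ≡ y v) → prodIn e x ≡ prodIn e y
prodIn-cong [] _ = refl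
prodIn-cong (inside ∷ e) x≗y = cong₂ _*_ (x≗y Vec.here) (prodIn-cong e (x≗y ∘ Vec.there))
prodIn-cong (outside ∷ e) x≗y = cong (1 *_) (prodIn-cong e (x≗y ∘ Vec.there))

prodIn-true : ∀ {n} (e : Subset n) {X : Fin n → Bool} → (∀ {v} → v ∈ₛ e → X v ≡ true) → prodIn e (boolToℕ ∘ X) ≡ 1
prodIn-true [] _ = refl
prodIn-true (inside ∷ e) X-true rewrite X-true Vec.here = trans (+-identityʳ _) (prodIn-true e (X-true ∘ Vec.there))
prodIn-true (outside ∷ e) X-true = trans (+-identityʳ _) (prodIn-true e (X-true ∘ Vec.there))

prodIn-false : ∀ {n} {e : Subset n} {X : Fin n → Bool} {v} → v ∈ₛ e → X v ≡ false → prodIn e (boolToℕ ∘ X) ≡ 0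
prodIn-false {X = X} Vec.here Xv≡false rewrite Xv≡false = refl
prodIn-false {e = b ∷ _} {X} (Vec.there v∈e) Xv≡false
  rewrite prodIn-false {X = X ∘ suc} v∈e Xv≡false = *-zeroʳ (if b then boolToℕ (X zero) else 1)

prodIn-pre : ∀ {n} {σ σ⁻¹ : Fin n → Fin n} → (∀ v → σ (σ⁻¹ v) ≡ v) → (X : Fin n → Bool) → (∀ v → X (σ v) ≡ X v) →
             ∀ e → prodIn (pre σ e) (boolToℕ ∘ X) ≡ prodIn e (boolToℕ ∘ X)
prodIn-pre {σ = σ} {σ⁻¹} σσ⁻¹ X X-inv e with Fin.any? (λ w → (w ∈ₛ? e) ×-dec (X w Bool.≟ false))
... | yes (w , w∈e , Xw≡false) =
  trans (prodIn-false σ⁻¹w∈pre (trans (sym (X-inv (σ⁻¹ w))) (trans (cong X (σσ⁻¹ w)) Xw≡false)))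
        (sym (prodIn-false w∈e Xw≡false))
  where
  σ⁻¹w∈pre : σ⁻¹ w ∈ₛ pre σ e
  σ⁻¹w∈pre = ∈-pre⁺ (subst (_∈ₛ e) (sym (σσ⁻¹ w)) w∈e)
... | no ¬false = trans (prodIn-true (pre σ e) λ v∈pre → trans (sym (X-inv _)) (true-on-e (∈-pre⁻ v∈pre)))
                        (sym (prodIn-true e true-on-e))
  where
  true-on-e : ∀ {v} → v ∈ₛ e → X v ≡ true
  true-on-e {v} v∈e = Bool.¬-not (λ Xv≡false → ¬false (v , v∈e , Xv≡false))

P-pre : ∀ {p n} .{{_ : NonZero p}} (L : Labeling p n) {σ σ⁻¹ : Fin n → Fin n} →
        (∀ v → σ (σ⁻¹ v) ≡ v) → (∀ v → σ⁻¹ (σ v) ≡ v) → (X : Fin n → Bool) → (∀ v → X (σ v) ≡ X v) →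
        P (L ∘ pre σ) (boolToℕ ∘ X) ≡ P L (boolToℕ ∘ X)
P-pre {p} {n} L {σ} {σ⁻¹} σσ⁻¹ σ⁻¹σ X X-inv = cong (_% p) (begin
  ∑ (allSubsets n) (λ e → toℕ (L (pre σ e)) * prodIn e x) ≡⟨ ∑-cong (allSubsets n) (λ {e} _ → cong (toℕ (L (pre σ e)) *_) (moved e)) ⟩
  ∑ (allSubsets n) (term ∘ pre σ)                          ≡⟨ ∑-reindex (allSubsets-unique n) allSubsets-complete
                                                                (pre σ) (pre σ⁻¹) (pre-inverse σ⁻¹σ) (pre-inverse σσ⁻¹) term ⟩
  ∑ (allSubsets n) term                                    ∎)
  where
  open ≡-Reasoning
  moved = λ e → sym (prodIn-pre σσ⁻¹ X X-inv e)
  x = boolToℕ ∘ X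
  term = λ e → toℕ (L e) * prodIn e x

P-cong : ∀ {p n} .{{_ : NonZero p}} {L L′ : Labeling p n} → (∀ e → L e ≡ L′ e) → ∀ x → P L x ≡ P L′ x
P-cong {p} {n} L≗L′ x = cong (_% p) (∑-cong (allSubsets n) λ {e} _ → cong (λ z → toℕ z * prodIn e x) (L≗L′ e))

ones-true : ∀ {n M} {v : Fin n} → toℕ v < M → ones M v ≡ true
ones-true v<M = Equivalence.to Bool.T-≡ (<⇒<ᵇ v<M)

ones-false : ∀ {n M} {v : Fin n} → M ≤ toℕ v → ones M v ≡ false
ones-false {M = M} {v} M≤v with toℕ v <ᵇ M in eq
... | false = refl
... | true = contradiction (<ᵇ⇒< (toℕ v) M (subst T (sym eq) tt)) (≤⇒≯ M≤v)

periodicPermutation : ∀ {n} (f : Fin n → Fin n) t .{{_ : NonZero t}} → (∀ v → iter f t v ≡ v) → Permutation′ n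
periodicPermutation f t periodic = permutation f (iter f (pred t)) (proj₁ inverse) (proj₂ inverse)
  where
  inverse = periodic⇒inverse f (pred t) (λ v → subst (λ k → iter f k v ≡ v) (sym (suc-pred t)) (periodic v))

module Window (n m ρ : ℕ) .{{_ : NonZero ρ}} (fits : m + ρ ≤ n) where

  InWindow : Fin n → Set
  InWindow v = m ≤ toℕ v × toℕ v < m + ρ

  inWindow? : ∀ v → Dec (InWindow v)
  inWindow? v = (m ≤? toℕ v) ×-dec (toℕ v <? m + ρ)

  private
    offset : ∀ {v} → InWindow v → toℕ v ∸ m < ρ
    offset (m≤v , v<m+ρ) = subst (_ <_) (m+n∸m≡n m ρ) (∸-monoˡ-< v<m+ρ m≤v)

    shifted : ℕ → Fin n → ℕ
    shifted s v = m + (toℕ v ∸ m + s) % ρ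

    shifted<m+ρ : ∀ s v → shifted s v < m + ρ
    shifted<m+ρ s v = +-monoʳ-< m (m%n<n _ ρ)

  rotate : ℕ → Fin n → Fin n
  rotate s v with inWindow? v
  ... | yes _ = fromℕ< (<-≤-trans (shifted<m+ρ s v) fits)
  ... | no _ = v

  toℕ-rotate : ∀ s {v} → InWindow v → toℕ (rotate s v) ≡ shifted s v
  toℕ-rotate s {v} w with inWindow? v
  ... | yes _ = Fin.toℕ-fromℕ< _
  ... | no ¬w = contradiction w ¬w

  rotate-outside : ∀ s {v} → ¬ InWindow v → rotate s v ≡ v
  rotate-outside s {v} ¬w with inWindow? v
  ... | yes w = contradiction w ¬w
  ... | no _ = refl

  rotate-inside : ∀ s {v} → InWindow v → InWindow (rotate s v)
  rotate-inside s {v} w rewrite toℕ-rotate s w = m≤m+n m _ , shifted<m+ρ s v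

  rotate-+ : ∀ a b v → rotate a (rotate b v) ≡ rotate (a + b) v
  rotate-+ a b v = by (inWindow? v)
    where
    open ≡-Reasoning
    y = toℕ v ∸ m + b
    +-assoc-comm : ∀ x y z → x + y + z ≡ x + (z + y)
    +-assoc-comm = solve-∀
    by : Dec (InWindow v) → rotate a (rotate b v) ≡ rotate (a + b) v
    by (no ¬w) =
      trans (cong (rotate a) (rotate-outside b ¬w)) (trans (rotate-outside a ¬w) (sym (rotate-outside (a + b) ¬w)))
    by (yes w) = Fin.toℕ-injective (begin
      toℕ (rotate a (rotate b v))            ≡⟨ toℕ-rotate a (rotate-inside b w) ⟩
      m + (toℕ (rotate b v) ∸ m + a) % ρ     ≡⟨ cong (λ z → m + (z ∸ m + a) % ρ) (toℕ-rotate b w) ⟩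
      m + (m + y % ρ ∸ m + a) % ρ            ≡⟨ cong (λ z → m + (z + a) % ρ) (m+n∸m≡n m (y % ρ)) ⟩
      m + (y % ρ + a) % ρ                    ≡⟨ cong (m +_) (%-distribˡ-+ (y % ρ) a ρ) ⟩
      m + (y % ρ % ρ + a % ρ) % ρ            ≡⟨ cong (λ z → m + (z + a % ρ) % ρ) (m%n%n≡m%n y ρ) ⟩
      m + (y % ρ + a % ρ) % ρ                ≡⟨ cong (m +_) (%-distribˡ-+ y a ρ) ⟨
      m + (y + a) % ρ                        ≡⟨ cong (λ z → m + z % ρ) (+-assoc-comm (toℕ v ∸ m) b a) ⟩
      m + (toℕ v ∸ m + (a + b)) % ρ          ≡⟨ toℕ-rotate (a + b) w ⟨
      toℕ (rotate (a + b) v)                 ∎)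

  rotate-* : ∀ c v → rotate (c * ρ) v ≡ v
  rotate-* c v = by (inWindow? v)
    where
    open ≡-Reasoning
    by : Dec (InWindow v) → rotate (c * ρ) v ≡ v
    by (no ¬w) = rotate-outside (c * ρ) ¬w
    by (yes w@(m≤v , _)) = Fin.toℕ-injective (begin
      toℕ (rotate (c * ρ) v)          ≡⟨ toℕ-rotate (c * ρ) w ⟩
      m + (toℕ v ∸ m + c * ρ) % ρ     ≡⟨ cong (m +_) ([m+kn]%n≡m%n (toℕ v ∸ m) c ρ) ⟩
      m + (toℕ v ∸ m) % ρ             ≡⟨ cong (m +_) (m<n⇒m%n≡m (offset w)) ⟩
      m + (toℕ v ∸ m)                 ≡⟨ m+[n∸m]≡n m≤v ⟩
      toℕ v                           ∎)

  iter-rotate : ∀ s j v → iter (rotate s) j v ≡ rotate (j * s) v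
  iter-rotate s zero v = sym (rotate-* 0 v)
  iter-rotate s (suc j) v = trans (cong (rotate s) (iter-rotate s j v)) (rotate-+ s (j * s) v)

  rotate-periodic : ∀ s t → s * t ≡ ρ → ∀ v → iter (rotate s) t v ≡ v
  rotate-periodic s t st≡ρ v = begin
    iter (rotate s) t v    ≡⟨ iter-rotate s t v ⟩
    rotate (t * s) v       ≡⟨ cong (λ k → rotate k v) (trans (*-comm t s) (trans st≡ρ (sym (*-identityˡ ρ)))) ⟩
    rotate (1 * ρ) v       ≡⟨ rotate-* 1 v ⟩
    v                      ∎
    where open ≡-Reasoning

  rotate-aperiodic : ∀ s t → s * t ≡ ρ → ∀ {v} → InWindow v → ∀ {j} → 0 < j → j < t → iter (rotate s) j v ≢ v
  rotate-aperiodic s t st≡ρ {v} w@(m≤v , _) {j} 0<j j<t returns = not-multiple K j≡Kt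
    where
    x = toℕ v ∸ m
    K = (x + j * s) / ρ
    x+js%ρ≡x : (x + j * s) % ρ ≡ x
    x+js%ρ≡x = +-cancelˡ-≡ m _ _ (begin
      m + (x + j * s) % ρ         ≡⟨ toℕ-rotate (j * s) w ⟨
      toℕ (rotate (j * s) v)      ≡⟨ cong toℕ (trans (sym (iter-rotate s j v)) returns) ⟩
      toℕ v                       ≡⟨ m+[n∸m]≡n m≤v ⟨
      m + x                       ∎)
      where open ≡-Reasoning
    js≡Kts : j * s ≡ K * t * s
    js≡Kts = +-cancelˡ-≡ x _ _ (begin
      x + j * s                   ≡⟨ m≡m%n+[m/n]*n (x + j * s) ρ ⟩
      (x + j * s) % ρ + K * ρ     ≡⟨ cong₂ _+_ x+js%ρ≡x (cong (K *_) (trans (sym st≡ρ) (*-comm s t))) ⟩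
      x + K * (t * s)             ≡⟨ cong (x +_) (*-assoc K t s) ⟨
      x + K * t * s               ∎)
      where open ≡-Reasoning
    j≡Kt : j ≡ K * t
    j≡Kt = *-cancelʳ-≡ j (K * t) s {{≢-nonZero λ { refl → ≢-nonZero⁻¹ ρ (sym st≡ρ) }}} js≡Kts
    not-multiple : ∀ k → j ≢ k * t
    not-multiple zero j≡0 = <⇒≢ 0<j (sym j≡0)
    not-multiple (suc k) j≡t+kt = <⇒≱ j<t (subst (t ≤_) (sym j≡t+kt) (m≤m+n t (k * t)))

  ones-rotate : ∀ {M} → M ≤ m ⊎ m + ρ ≤ M → ∀ s v → ones M (rotate s v) ≡ ones M v
  ones-rotate {M} M-outside s v = by (inWindow? v)
    where
    by : Dec (InWindow v) → ones M (rotate s v) ≡ ones M v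
    by (no ¬w) = cong (ones M) (rotate-outside s ¬w)
    by (yes w) = both-inside M-outside (rotate-inside s w) w
      where
      both-inside : M ≤ m ⊎ m + ρ ≤ M → ∀ {u v} → InWindow u → InWindow v → ones M u ≡ ones M v
      both-inside (inj₁ M≤m) (m≤u , _) (m≤v , _) =
        trans (ones-false (≤-trans M≤m m≤u)) (sym (ones-false (≤-trans M≤m m≤v)))
      both-inside (inj₂ m+ρ≤M) (_ , u<m+ρ) (_ , v<m+ρ) =
        trans (ones-true (<-≤-trans u<m+ρ m+ρ≤M)) (sym (ones-true (<-≤-trans v<m+ρ m+ρ≤M)))

  ones-outside : ∀ {v} → ¬ InWindow v → ones (m + ρ) v ≡ ones m v
  ones-outside {v} ¬w with m ≤? toℕ v
  ... | yes m≤v = trans (ones-false (≮⇒≥ (λ v<m+ρ → ¬w (m≤v , v<m+ρ)))) (sym (ones-false m≤v))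
  ... | no m≰v = trans (ones-true (<-≤-trans (≰⇒> m≰v) (m≤m+n m ρ))) (sym (ones-true (≰⇒> m≰v)))

  rotation : ∀ s t .{{_ : NonZero t}} → s * t ≡ ρ → Permutation′ n
  rotation s t st≡ρ = periodicPermutation (rotate s) t (rotate-periodic s t st≡ρ)

-- Automorphisms and the fully symmetric set

transpose-left : ∀ {n} (i j : Fin n) → transpose i j ⟨$⟩ʳ i ≡ j
transpose-left i j rewrite dec-true (i Fin.≟ i) refl = refl

transpose-fixes : ∀ {n} {i j k : Fin n} → k ≢ i → k ≢ j → transpose i j ⟨$⟩ʳ k ≡ k
transpose-fixes {i = i} {j} {k} k≢i k≢j rewrite dec-false (k Fin.≟ i) k≢i | dec-false (k Fin.≟ j) k≢j = refl

module _ {n : ℕ} where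

  ⟨$⟩ʳ-injective : ∀ (π : Permutation′ n) {u v} → π ⟨$⟩ʳ u ≡ π ⟨$⟩ʳ v → u ≡ v
  ⟨$⟩ʳ-injective π eq = trans (sym (inverseˡ π)) (trans (cong (π ⟨$⟩ˡ_) eq) (inverseˡ π))

  ∣preimage∣ : ∀ (π : Permutation′ n) e → ∣ preimage π e ∣ ≡ ∣ e ∣
  ∣preimage∣ π = ∣pre∣ (λ _ → inverseʳ π) (λ _ → inverseˡ π)

  0<∣∣⇒Nonempty : ∀ {e : Subset n} → 0 < ∣ e ∣ → Nonempty e
  0<∣∣⇒Nonempty {e} 0<∣e∣ with nonempty? e
  ... | yes ne = ne
  ... | no empty = contradiction (trans (cong ∣_∣ (Empty-unique empty)) (∣⊥∣≡0 n)) (>⇒≢ 0<∣e∣)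

  ∩∁-≡ : ∀ {C e₁ e₂ : Subset n} → (∀ {y} → y ∉ₛ C → y ∈ₛ e₁ → y ∈ₛ e₂) → (∀ {y} → y ∉ₛ C → y ∈ₛ e₂ → y ∈ₛ e₁) →
         e₁ ∩ ∁ C ≡ e₂ ∩ ∁ C
  ∩∁-≡ {C} {e₁} {e₂} to from = ⊆-antisym (transfer to) (transfer from)
    where
    transfer : ∀ {e e′} → (∀ {y} → y ∉ₛ C → y ∈ₛ e → y ∈ₛ e′) → e ∩ ∁ C ⊆ e′ ∩ ∁ C
    transfer {e} f y∈ with y∈e , y∈∁C ← x∈p∩q⁻ e (∁ C) y∈ = x∈p∩q⁺ (f (x∈∁p⇒x∉p y∈∁C) y∈e , y∈∁C)

module _ {p n : ℕ} (lab : Labeling p n) where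

  IsAut-flip : ∀ {a} → IsAut lab a → IsAut lab (flip a)
  IsAut-flip {a} a-aut e = trans (sym (a-aut (preimage (flip a) e))) (cong lab (pre-inverse (λ _ → inverseˡ a) e))

  IsAut-∘ : ∀ {a b} → IsAut lab a → IsAut lab b → IsAut lab (a ∘ₚ b)
  IsAut-∘ {a} {b} a-aut b-aut e = trans (cong lab (sym (pre-∘ _ _ e))) (trans (a-aut (preimage b e)) (b-aut e))

  fullySymmetric⇒IsAut : ∀ {C} → FullySymmetric lab C → ∀ {ν} → (∀ {u} → u ∉ₛ C → ν ⟨$⟩ʳ u ≡ u) → IsAut lab ν
  fullySymmetric⇒IsAut {C} fs {ν} fixes e with nonempty? e
  ... | yes (x , x∈e) = fs (preimage ν e) e (ν ⟨$⟩ˡ x , ∈-pre⁺ (subst (_∈ₛ e) (sym (inverseʳ ν)) x∈e)) (x , x∈e)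
                           (∣preimage∣ ν e)
                           (∩∁-≡ (λ u∉C u∈pre → subst (_∈ₛ e) (fixes u∉C) (∈-pre⁻ u∈pre))
                                 (λ u∉C u∈e → ∈-pre⁺ (subst (_∈ₛ e) (sym (fixes u∉C)) u∈e)))
  ... | no empty = cong lab (trans (Empty-unique (λ (_ , u∈pre) → empty (_ , ∈-pre⁻ u∈pre))) (sym (Empty-unique empty)))

  singletons⇒FullySymmetric : ∀ {D} → (∀ e → 2 ≤ ∣ e ∣ → toℕ (lab e) ≡ 0) →
                              (∀ {x y} → x ∈ₛ D → y ∈ₛ D → lab ⁅ x ⁆ ≡ lab ⁅ y ⁆) → FullySymmetric lab D
  singletons⇒FullySymmetric {D} large≡0 same e₁ e₂ (x₁ , x₁∈e₁) (x₂ , x₂∈e₂) ∣e₁∣≡∣e₂∣ e₁∩≡e₂∩ with 2 ≤? ∣ e₁ ∣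
  ... | yes 2≤∣e₁∣ = Fin.toℕ-injective (trans (large≡0 e₁ 2≤∣e₁∣) (sym (large≡0 e₂ (subst (2 ≤_) ∣e₁∣≡∣e₂∣ 2≤∣e₁∣))))
  ... | no 2≰∣e₁∣ = by (x₁ ∈ₛ? D) (x₂ ∈ₛ? D)
    where
    ∣e₁∣≡1 : ∣ e₁ ∣ ≡ 1
    ∣e₁∣≡1 = ≤-antisym (≤-pred (≰⇒> 2≰∣e₁∣)) (∈⇒0<∣∣ x₁∈e₁)
    ∣e₂∣≡1 = trans (sym ∣e₁∣≡∣e₂∣) ∣e₁∣≡1
    crosses : ∀ {y e e′} → e ∩ ∁ D ≡ e′ ∩ ∁ D → y ∉ₛ D → y ∈ₛ e → y ∈ₛ e′
    crosses {y} {e} {e′} eq y∉D y∈e = proj₁ (x∈p∩q⁻ e′ (∁ D) (subst (y ∈ₛ_) eq (x∈p∩q⁺ (y∈e , x∉p⇒x∈∁p y∉D))))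
    by : Dec (x₁ ∈ₛ D) → Dec (x₂ ∈ₛ D) → lab e₁ ≡ lab e₂
    by (yes x₁∈D) (yes x₂∈D) = begin
      lab e₁      ≡⟨ cong lab (∣∣≡1⇒≡⁅⁆ ∣e₁∣≡1 x₁∈e₁) ⟩
      lab ⁅ x₁ ⁆  ≡⟨ same x₁∈D x₂∈D ⟩
      lab ⁅ x₂ ⁆  ≡⟨ cong lab (∣∣≡1⇒≡⁅⁆ ∣e₂∣≡1 x₂∈e₂) ⟨
      lab e₂      ∎
      where open ≡-Reasoning
    by (no x₁∉D) _ = cong lab (trans (∣∣≡1⇒≡⁅⁆ ∣e₁∣≡1 x₁∈e₁) (sym (∣∣≡1⇒≡⁅⁆ ∣e₂∣≡1 (crosses e₁∩≡e₂∩ x₁∉D x₁∈e₁))))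
    by _ (no x₂∉D) = cong lab (trans (∣∣≡1⇒≡⁅⁆ ∣e₁∣≡1 (crosses (sym e₁∩≡e₂∩) x₂∉D x₂∈e₂)) (sym (∣∣≡1⇒≡⁅⁆ ∣e₂∣≡1 x₂∈e₂)))

  preimage-⁅⁆ : ∀ (a : Permutation′ n) x → preimage a ⁅ a ⟨$⟩ʳ x ⁆ ≡ ⁅ x ⁆
  preimage-⁅⁆ a x = ⊆-antisym
    (λ v∈pre → subst (_∈ₛ ⁅ x ⁆) (sym (⟨$⟩ʳ-injective a (x∈⁅y⁆⇒x≡y _ (∈-pre⁻ v∈pre)))) (x∈⁅x⁆ x))
    (λ v∈⁅x⁆ → ∈-pre⁺ (subst (λ v → a ⟨$⟩ʳ v ∈ₛ ⁅ a ⟨$⟩ʳ x ⁆) (sym (x∈⁅y⁆⇒x≡y x v∈⁅x⁆)) (x∈⁅x⁆ _)))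

  module _ {C : Subset n} (maximal : MaximalFullySymmetric lab C) (purified : SymmetryPurified lab C) where

    private
      symmetric = proj₁ maximal
      inside-or-outside = proj₁ (proj₂ purified)
      outside-singleton = proj₂ (proj₂ purified)

      LargeEdgeIn : Subset n → Set
      LargeEdgeIn e = e ⊆ C × 2 ≤ ∣ e ∣ × toℕ (lab e) ≢ 0

      largeEdgeIn? : ∀ e → Dec (LargeEdgeIn e)
      largeEdgeIn? e = (e ⊆? C) ×-dec (2 ≤? ∣ e ∣) ×-dec ¬? (toℕ (lab e) ≟ 0)

      edge⇒⊆C : ∀ {e} → toℕ (lab e) ≢ 0 → 2 ≤ ∣ e ∣ → e ⊆ C
      edge⇒⊆C {e} edge 2≤∣e∣ with inside-or-outside e edge
      ... | inj₁ e⊆C = e⊆C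
      ... | inj₂ e⊆∁C = contradiction (outside-singleton e edge e⊆∁C) (>⇒≢ 2≤∣e∣)

      -- move the large edge onto x by a transposition inside C, then transport it by a
      ∈C-via-largeEdge : ∀ {e} → LargeEdgeIn e → ∀ {a} → IsAut lab a → ∀ {x} → x ∈ₛ C → a ⟨$⟩ʳ x ∈ₛ C
      ∈C-via-largeEdge {e} (e⊆C , 2≤∣e∣ , edge) {a} a-aut {x} x∈C = edge⇒⊆C edge′ 2≤∣e′∣ ax∈e′
        where
        u-witness = 0<∣∣⇒Nonempty (≤-trans (s≤s z≤n) 2≤∣e∣)
        u = proj₁ u-witness
        u∈e = proj₂ u-witness
        t = transpose x u
        t-aut : IsAut lab t
        t-aut = fullySymmetric⇒IsAut symmetric {t} λ y∉C →
          transpose-fixes (λ { refl → y∉C x∈C }) (λ { refl → y∉C (e⊆C u∈e) })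
        a⁻¹t = flip a ∘ₚ t
        e′ = preimage a⁻¹t e
        edge′ : toℕ (lab e′) ≢ 0
        edge′ = edge ∘ trans (cong toℕ (sym (IsAut-∘ {flip a} {t} (IsAut-flip {a} a-aut) t-aut e)))
        2≤∣e′∣ : 2 ≤ ∣ e′ ∣
        2≤∣e′∣ = subst (2 ≤_) (sym (∣preimage∣ a⁻¹t e)) 2≤∣e∣
        ax∈e′ : a ⟨$⟩ʳ x ∈ₛ e′
        ax∈e′ = ∈-pre⁺ (subst (_∈ₛ e) (sym (trans (cong (t ⟨$⟩ʳ_) (inverseˡ a {x})) (transpose-left x u))) u∈e)

      -- without large edges C ∪ {a x} is still fully symmetric, so maximality puts a x in C
      ∈C-via-maximality : ¬ (∃[ e ] LargeEdgeIn e) → ∀ {a} → IsAut lab a → ∀ {x} → x ∈ₛ C → a ⟨$⟩ʳ x ∈ₛ C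
      ∈C-via-maximality no-large-edge {a} a-aut {x} x∈C =
        proj₂ maximal (C ∪ ⁅ a ⟨$⟩ʳ x ⁆) (p⊆p∪q _) extended-symmetric (x∈p∪q⁺ (inj₂ (x∈⁅x⁆ _)))
        where
        large≡0 : ∀ e → 2 ≤ ∣ e ∣ → toℕ (lab e) ≡ 0
        large≡0 e 2≤∣e∣ with toℕ (lab e) ≟ 0
        ... | yes ≡0 = ≡0
        ... | no edge = contradiction (e , (λ {_} → edge⇒⊆C edge 2≤∣e∣) , 2≤∣e∣ , edge) no-large-edge
        lab⁅⁆≡lab⁅x⁆ : ∀ {y} → y ∈ₛ C ∪ ⁅ a ⟨$⟩ʳ x ⁆ → lab ⁅ y ⁆ ≡ lab ⁅ x ⁆
        lab⁅⁆≡lab⁅x⁆ {y} y∈ with x∈p∪q⁻ C _ y∈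
        ... | inj₁ y∈C = symmetric ⁅ y ⁆ ⁅ x ⁆ (y , x∈⁅x⁆ y) (x , x∈⁅x⁆ x) (trans (∣⁅x⁆∣≡1 y) (sym (∣⁅x⁆∣≡1 x)))
                           (∩∁-≡ (λ z∉C z∈⁅y⁆ → contradiction (subst (_∈ₛ C) (sym (x∈⁅y⁆⇒x≡y y z∈⁅y⁆)) y∈C) z∉C)
                                 (λ z∉C z∈⁅x⁆ → contradiction (subst (_∈ₛ C) (sym (x∈⁅y⁆⇒x≡y x z∈⁅x⁆)) x∈C) z∉C))
        ... | inj₂ y∈⁅ax⁆ rewrite x∈⁅y⁆⇒x≡y _ y∈⁅ax⁆ =
          trans (sym (a-aut ⁅ a ⟨$⟩ʳ x ⁆)) (cong lab (preimage-⁅⁆ a x))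
        extended-symmetric : FullySymmetric lab (C ∪ ⁅ a ⟨$⟩ʳ x ⁆)
        extended-symmetric = singletons⇒FullySymmetric large≡0 λ y₁∈ y₂∈ →
          trans (lab⁅⁆≡lab⁅x⁆ y₁∈) (sym (lab⁅⁆≡lab⁅x⁆ y₂∈))

    IsAut⇒∈C : ∀ {a} → IsAut lab a → ∀ {x} → x ∈ₛ C → a ⟨$⟩ʳ x ∈ₛ C
    IsAut⇒∈C {a} a-aut x∈C with anySubset? largeEdgeIn?
    ... | yes (_ , large) = ∈C-via-largeEdge large {a} a-aut x∈C
    ... | no no-large-edge = ∈C-via-maximality no-large-edge {a} a-aut x∈C

    IsAut⇒∉C : ∀ {a} → IsAut lab a → ∀ {x} → x ∉ₛ C → a ⟨$⟩ʳ x ∉ₛ C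
    IsAut⇒∉C {a} a-aut x∉C ax∈C = x∉C (subst (_∈ₛ C) (inverseˡ a) (IsAut⇒∈C {flip a} (IsAut-flip {a} a-aut) ax∈C))

-- The action on cosets and the periodicity

module CosetAction {p n k} (lab : Labeling p n) (πs : Fin k → Permutation′ n) (transversal : IsLeftTransversal lab πs) where

  Represents : Fin k → (Fin n → Fin n) → Set
  Represents j f = Σ (Permutation′ n) λ a → IsAut lab a × ∀ v → f v ≡ πs j ⟨$⟩ʳ (a ⟨$⟩ʳ v)

  coset : Permutation′ n → Fin k
  coset ψ = proj₁ (transversal ψ)

  coset-represents : ∀ ψ → Represents (coset ψ) (ψ ⟨$⟩ʳ_)
  coset-represents ψ = proj₁ (proj₂ (transversal ψ))

  coset-unique : ∀ ψ {j} → Represents j (ψ ⟨$⟩ʳ_) → j ≡ coset ψ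
  coset-unique ψ = proj₂ (proj₂ (transversal ψ)) _

  represents-self : ∀ j → Represents j (πs j ⟨$⟩ʳ_)
  represents-self j = id , cong lab ∘ pre-id , λ _ → refl

  module _ (σ : Permutation′ n) where

    shift : Fin k → Fin k
    shift i = coset (πs i ∘ₚ σ)

    represents-shift : ∀ i → Represents (shift i) (λ v → σ ⟨$⟩ʳ (πs i ⟨$⟩ʳ v))
    represents-shift i = coset-represents (πs i ∘ₚ σ)

    represents-iter : ∀ j i → Represents (iter shift j i) (λ v → iter (σ ⟨$⟩ʳ_) j (πs i ⟨$⟩ʳ v))
    represents-iter zero i = represents-self i
    represents-iter (suc j) i with a , a-aut , eq ← represents-iter j i
                                 | a′ , a′-aut , eq′ ← represents-shift (iter shift j i) =
      a ∘ₚ a′ , IsAut-∘ lab {a} {a′} a-aut a′-aut , λ v → trans (cong (σ ⟨$⟩ʳ_) (eq v)) (eq′ (a ⟨$⟩ʳ v))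

    shift-periodic : ∀ t → (∀ v → iter (σ ⟨$⟩ʳ_) t v ≡ v) → ∀ i → iter shift t i ≡ i
    shift-periodic t σ-periodic i with a , a-aut , eq ← represents-iter t i =
      trans (coset-unique (πs i) (a , a-aut , λ v → trans (sym (σ-periodic _)) (eq v)))
            (sym (coset-unique (πs i) (represents-self i)))

    act-shift : ∀ i e → act (πs (shift i)) lab e ≡ act (πs i) lab (preimage σ e)
    act-shift i e with a , a-aut , eq ← represents-shift i = begin
      lab (preimage (πs (shift i)) e)             ≡⟨ a-aut _ ⟨
      lab (pre (a ⟨$⟩ʳ_) (preimage (πs (shift i)) e)) ≡⟨ cong lab (pre-∘ _ _ e) ⟩
      lab (pre (λ v → πs (shift i) ⟨$⟩ʳ (a ⟨$⟩ʳ v)) e) ≡⟨ cong lab (pre-cong (sym ∘ eq) e) ⟩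
      lab (pre (λ v → σ ⟨$⟩ʳ (πs i ⟨$⟩ʳ v)) e)   ≡⟨ cong lab (pre-∘ _ _ e) ⟨
      lab (preimage (πs i) (preimage σ e))        ∎
      where open ≡-Reasoning

module Periodicity {p q : ℕ} (p-prime : Prime p) (q-prime : Prime q) (r : Fin p) {d n : ℕ} (lab : Labeling p n)
                   (hypergraph : IsHypergraph d lab) {C : Subset n} (maximal : MaximalFullySymmetric lab C)
                   (purified : SymmetryPurified lab C) {kp kq : ℕ} (d<pᵏ : d < p ^ kp) (∣∁C∣<qᵏ : n ∸ ∣ C ∣ < q ^ kq)
                   {k : ℕ} (πs : Fin k → Permutation′ n) (transversal : IsLeftTransversal lab πs) where

  pᵏ qᵏ ρ : ℕ
  pᵏ = p ^ kp
  qᵏ = q ^ kq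
  ρ = pᵏ * qᵏ

  instance
    p-nonZero : NonZero p
    p-nonZero = prime⇒nonZero p-prime
    q-nonZero : NonZero q
    q-nonZero = prime⇒nonZero q-prime
    pᵏ-nonZero : NonZero pᵏ
    pᵏ-nonZero = m^n≢0 p kp
    qᵏ-nonZero : NonZero qᵏ
    qᵏ-nonZero = m^n≢0 q kq
    ρ-nonZero : NonZero ρ
    ρ-nonZero = m*n≢0 pᵏ qᵏ

  open CosetAction lab πs transversal

  module _ {m : ℕ} (fits : m + ρ ≤ n) where

    open Window n m ρ fits

    σ σ′ : Permutation′ n
    σ = rotation pᵏ qᵏ refl
    σ′ = rotation qᵏ pᵏ (*-comm qᵏ pᵏ)

    τ : Fin k → Fin k
    τ = shift σ

    hits : ℕ → Fin k → ℕ
    hits M i = b (P (act (πs i) lab) (boolToℕ ∘ ones M)) r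

    hits-shift : ∀ {M} → M ≤ m ⊎ m + ρ ≤ M → ∀ i → hits M (τ i) ≡ hits M i
    hits-shift {M} M-outside i = cong (λ z → b z r) (begin
      P (act (πs (τ i)) lab) x                ≡⟨ P-cong (act-shift σ i) x ⟩
      P (act (πs i) lab ∘ preimage σ) x       ≡⟨ P-pre (act (πs i) lab) (λ _ → inverseʳ σ) (λ _ → inverseˡ σ)
                                                     (ones M) (ones-rotate M-outside pᵏ) ⟩
      P (act (πs i) lab) x                    ∎)
      where
      open ≡-Reasoning
      x = boolToℕ ∘ ones M

    module FixedCoset (i : Fin k) (fixed : τ i ≡ i) where

      private
        πᵢ : Permutation′ n
        πᵢ = πs i
        conjugate : Represents i (λ v → σ ⟨$⟩ʳ (πᵢ ⟨$⟩ʳ v))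
        conjugate = subst (λ j → Represents j (λ v → σ ⟨$⟩ʳ (πᵢ ⟨$⟩ʳ v))) fixed (represents-shift σ i)
        a : Permutation′ n
        a = proj₁ conjugate
        a-aut : IsAut lab a
        a-aut = proj₁ (proj₂ conjugate)
        σπᵢ≡πᵢa : ∀ v → σ ⟨$⟩ʳ (πᵢ ⟨$⟩ʳ v) ≡ πᵢ ⟨$⟩ʳ (a ⟨$⟩ʳ v)
        σπᵢ≡πᵢa = proj₂ (proj₂ conjugate)

      -- an outside point of πᵢ⁻¹(window) would have an a-orbit of length qᵏ in ∁ C
      window⊆C : ∀ {w} → InWindow w → πᵢ ⟨$⟩ˡ w ∈ₛ C
      window⊆C {w} w∈W with πᵢ ⟨$⟩ˡ w ∈ₛ? C
      ... | yes v∈C = v∈C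
      ... | no v∉C = contradiction (unique⇒length≤∣∣ orbit-unique′ orbit⊆∁C) (<⇒≱ (begin-strict
        ∣ ∁ C ∣                          ≡⟨ ∣∁p∣≡n∸∣p∣ C ⟩
        n ∸ ∣ C ∣                        <⟨ ∣∁C∣<qᵏ ⟩
        qᵏ                               ≡⟨ length-applyUpTo _ qᵏ ⟨
        length (orbit (a ⟨$⟩ʳ_) qᵏ v)     ∎))
        where
        open ≤-Reasoning
        v = πᵢ ⟨$⟩ˡ w
        σ-follows-a : ∀ j → iter (σ ⟨$⟩ʳ_) j w ≡ πᵢ ⟨$⟩ʳ iter (a ⟨$⟩ʳ_) j v
        σ-follows-a j = trans (cong (iter (σ ⟨$⟩ʳ_) j) (sym (inverseʳ πᵢ))) (iter-conj (πᵢ ⟨$⟩ʳ_) σπᵢ≡πᵢa j v)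
        orbit-unique′ = orbit-unique (a ⟨$⟩ʳ_) (⟨$⟩ʳ-injective a) qᵏ v λ {j} 0<j j<qᵏ returns →
          rotate-aperiodic pᵏ qᵏ refl w∈W 0<j j<qᵏ
            (trans (σ-follows-a j) (trans (cong (πᵢ ⟨$⟩ʳ_) returns) (inverseʳ πᵢ)))
        orbit∉C : ∀ j → iter (a ⟨$⟩ʳ_) j v ∉ₛ C
        orbit∉C zero = v∉C
        orbit∉C (suc j) = IsAut⇒∉C lab maximal purified {a} a-aut (orbit∉C j)
        orbit⊆∁C : ∀ {x} → x ∈ orbit (a ⟨$⟩ʳ_) qᵏ v → x ∈ₛ ∁ C
        orbit⊆∁C x∈orbit with j , _ , refl ← ∈-applyUpTo⁻ _ x∈orbit = x∉p⇒x∈∁p (orbit∉C j)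

      H : Labeling p n
      H = act πᵢ lab

      H-invariant : ∀ e → H (preimage σ′ e) ≡ H e
      H-invariant e = begin
        lab (preimage πᵢ (preimage σ′ e))              ≡⟨ cong lab (pre-∘ _ _ e) ⟩
        lab (pre (λ v → σ′ ⟨$⟩ʳ (πᵢ ⟨$⟩ʳ v)) e)          ≡⟨ cong lab (pre-cong (λ _ → sym (inverseʳ πᵢ)) e) ⟩
        lab (pre (λ v → πᵢ ⟨$⟩ʳ (ν ⟨$⟩ʳ v)) e)           ≡⟨ cong lab (pre-∘ _ _ e) ⟨
        lab (preimage ν (preimage πᵢ e))               ≡⟨ ν-aut (preimage πᵢ e) ⟩
        lab (preimage πᵢ e)                            ∎
        where
        open ≡-Reasoning
        ν = πᵢ ∘ₚ σ′ ∘ₚ flip πᵢ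
        ν-aut : IsAut lab ν
        ν-aut = fullySymmetric⇒IsAut lab (proj₁ purified) {ν} λ {u} u∉C →
          trans (cong (πᵢ ⟨$⟩ˡ_) (rotate-outside qᵏ λ πᵢu∈W → u∉C (subst (_∈ₛ C) (inverseˡ πᵢ) (window⊆C πᵢu∈W))))
                (inverseˡ πᵢ)

      summand : ℕ → Subset n → ℕ
      summand M e = toℕ (H e) * prodIn e (boolToℕ ∘ ones M)

      summand-invariant : ∀ {M} → M ≤ m ⊎ m + ρ ≤ M → ∀ e → summand M (preimage σ′ e) ≡ summand M e
      summand-invariant M-outside e =
        cong₂ _*_ (cong toℕ (H-invariant e)) (prodIn-pre (λ _ → inverseʳ σ′) _ (ones-rotate M-outside qᵏ) e)

      -- a σ′-stable set meeting the window contains a whole σ′-orbit of length pᵏ > d, so it is no edge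
      summand-agree : ∀ e → preimage σ′ e ≡ e → summand (m + ρ) e ≡ summand m e
      summand-agree e stable with Fin.any? (λ w → (w ∈ₛ? e) ×-dec inWindow? w)
      ... | no disjoint = cong (toℕ (H e) *_) (prodIn-cong e λ {v} v∈e →
                            cong boolToℕ (ones-outside λ v∈W → disjoint (v , v∈e , v∈W)))
      ... | yes (w , w∈e , w∈W) = trans (cong (_* _) non-edge) (sym (cong (_* _) non-edge))
        where
        closed : ∀ j → iter (σ′ ⟨$⟩ʳ_) j w ∈ₛ e
        closed zero = w∈e
        closed (suc j) = ∈-pre⁻ (subst (_ ∈ₛ_) (sym stable) (closed j))
        orbit⊆e : ∀ {x} → x ∈ orbit (σ′ ⟨$⟩ʳ_) pᵏ w → x ∈ₛ e
        orbit⊆e x∈orbit with j , _ , refl ← ∈-applyUpTo⁻ _ x∈orbit = closed j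
        pᵏ≤∣e∣ : pᵏ ≤ ∣ e ∣
        pᵏ≤∣e∣ = subst (_≤ ∣ e ∣) (length-applyUpTo _ pᵏ) (unique⇒length≤∣∣
          (orbit-unique (σ′ ⟨$⟩ʳ_) (⟨$⟩ʳ-injective σ′) pᵏ w (rotate-aperiodic qᵏ pᵏ (*-comm qᵏ pᵏ) w∈W)) orbit⊆e)
        non-edge : toℕ (H e) ≡ 0
        non-edge = proj₂ hypergraph (preimage πᵢ e) (<-≤-trans d<pᵏ (subst (pᵏ ≤_) (sym (∣preimage∣ πᵢ e)) pᵏ≤∣e∣))

      hits-agree : hits (m + ρ) i ≡ hits m i
      hits-agree = cong (λ z → b z r) (∑-mod-fixedPoints _≟ₛ_ p-prime kp σ′-periodic (allSubsets-unique n)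
        (λ _ → allSubsets-complete _) (summand (m + ρ)) (summand m)
        (summand-invariant (inj₂ ≤-refl)) (summand-invariant (inj₁ ≤-refl)) (λ {e} _ → summand-agree e))
        where
        σ′-periodic : ∀ e → iter (preimage σ′) pᵏ e ≡ e
        σ′-periodic e = trans (pre-iter _ pᵏ e) (trans (pre-cong (rotate-periodic qᵏ pᵏ (*-comm qᵏ pᵏ)) e) (pre-id e))

    s-agree : s {q = q} lab πs r (ones (m + ρ)) ≡ s {q = q} lab πs r (ones m)
    s-agree = begin
      sumFin (hits (m + ρ)) % q        ≡⟨ cong (_% q) (sumFin≡∑ (hits (m + ρ))) ⟩
      ∑ (allFin k) (hits (m + ρ)) % q  ≡⟨ ∑-mod-fixedPoints Fin._≟_ q-prime kq τ-periodic (Unique.allFin⁺ k)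
                                            (λ _ → ∈-allFin _) (hits (m + ρ)) (hits m)
                                            (hits-shift (inj₂ ≤-refl)) (hits-shift (inj₁ ≤-refl))
                                            (λ {i} _ → FixedCoset.hits-agree i) ⟩
      ∑ (allFin k) (hits m) % q        ≡⟨ cong (_% q) (sumFin≡∑ (hits m)) ⟨
      sumFin (hits m) % q              ∎
      where
      open ≡-Reasoning
      τ-periodic = shift-periodic σ qᵏ (rotate-periodic pᵏ qᵏ refl)
      sumFin≡∑ : ∀ f → sumFin f ≡ ∑ (allFin k) f
      sumFin≡∑ f = trans (sumFin≡sum-tabulate f) (sym (∑-allFin f))

  period : IsPeriod (s {q = q} lab πs r) ρ
  period = >-nonZero⁻¹ ρ , λ m fits → s-agree fits

theorem13 : (p q : ℕ) (pp : Prime p) (pq : Prime q) → p ≢ q →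
    (r : Fin p) (d n : ℕ) (lab : Labeling p n) → IsHypergraph d lab →
    (C : Subset n) → MaximalFullySymmetric lab C → SymmetryPurified lab C →
    n < 2 * ∣ C ∣ →
    (kp kq : ℕ) → IsLeastExpAbove p d kp → IsLeastExpAbove q (n ∸ ∣ C ∣) kq →
    (k : ℕ) (πs : Fin k → Permutation′ n) → IsLeftTransversal lab πs →
    IsPeriod (s {{prime⇒nonZero pp}} {{prime⇒nonZero pq}} lab πs r) (p ^ kp * q ^ kq)
theorem13 p q p-prime q-prime _ r d n lab hypergraph C maximal purified _ kp kq (d<pᵏ , _) (∣∁C∣<qᵏ , _) k πs
          transversal =
  Periodicity.period p-prime q-prime r lab hypergraph maximal purified {kp} {kq} d<pᵏ ∣∁C∣<qᵏ πs transversal
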